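{- For every SeCeNL formula $\zeta$ over $\Sigma$ that uses no nominals (i.e. every boolean combination of the atomic formulas $\mathbf{init}(D_1/D_2)$, $\mathbf{anti}(D)$, $\mathbf{pref}(D)$, $\mathbf{implies}(D_1\leadsto D_2)$, $\mathbf{follows}(D_1\leadsto D_2/D_3)$, $\mathbf{triggers}(D_1\leadsto D_2/D_3)$ with $D,D_1,D_2,D_3$ SeCe formulas over $\Sigma$), and every nonempty word $\sigma$ over $\Sigma$, we have $\sigma\in L(\zeta)$ if and only if $\sigma\in L(\aleph(\zeta))$, where $L(\aleph(\zeta))=\{\sigma\mid\sigma\models\aleph(\zeta)\}$.
   Context: Words, intervals and QDDC: a word over $\Sigma$ is $\sigma=P_0\cdots P_n$, $P_i\subseteq\Sigma$, $\mathrm{dom}(\sigma)=\{0,\dots,n\}$; an interval is $[b,e]$ with $b\le e$ in $\mathrm{dom}(\sigma)$. QDDC formulas are built from propositional formulas $\varphi$ over $\Sigma$ by $\langle\varphi\rangle$ ($\varphi$ holds at $b$), $[\varphi]$ ($\varphi$ holds at all $b\le i<e$), $[[\varphi]]$ (at all $b\le i\le e$), $\{\{\varphi\}\}$ ($e=b+1$ and $\varphi$ at $b$), chop $D_1\hat{}D_2$ (some $b\le i\le e$ with $D_1$ on $[b,i]$ and $D_2$ on $[i,e]$), $\neg,\vee,\wedge,\Rightarrow$ (usual), Kleene star, $\exists p,\forall p$, and the length/count constraints $\mathit{slen}\bowtie c$ (with $\mathit{slen}=e-b$), $\mathit{scount}\,\varphi\bowtie c$, $\mathit{sdur}\,\varphi\bowtie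 c$. Derived: $\mathit{true}=\langle 1\rangle$; $\mathit{ext}$ holds iff $b<e$; $\Diamond D=\mathit{true}\,\hat{}\,D\,\hat{}\,\mathit{true}$; $\Box D=\neg\Diamond\neg D$. For $\sigma=P_0\cdots P_n$, $\sigma\models D$ iff $\sigma,[0,n]\models D$. A SeCe formula is a QDDC formula without $\exists,\forall$ and without $\neg$ applied to formulas. For a formula $D$, $\mathrm{focc}(D)=D\wedge\neg(D\,\hat{}\,\mathit{ext})$. Semantics of nominal-free atomic SeCeNL formulas (sets of nonempty words; $i,j,k,l$ range over $\mathrm{dom}(\sigma)$ with intervals well-formed): $L(\mathbf{pref}(D))=\{\sigma\mid \sigma'\models D\text{ for every prefix }\sigma'\text{ of }\sigma\}$; $L(\mathbf{init}(D_1/D_2))=\{\sigma\mid\forall j:\sigma,[0,j]\models D_2\Rightarrow\exists k\le j:\sigma,[0,k]\models D_1\}$; $L(\mathbf{anti}(D))=\{\sigma\mid\forall i,j:\sigma,[i,j]\not\models D\}$; $L(\mathbf{implies}(D_1\leadsto D_2))=\{\sigma\mid\forall i,j:\sigma,[i,j]\models D_1\Rightarrow\sigma,[i,j]\models D_2\}$; $L(\mathbf{follows}(D_1\leadsto D_2/D_3))=\{\sigma\mid\forall i,j:\sigma,[i,j]\models D_1\Rightarrow(\forall k:\sigma,[j,k]\models\mathrm{focc}(D_3)\Rightarrow\exists l\le k:\sigma,[j,l]\models D_2)\}$; $L(\mathbf{triggers}(D_1\leadsto D_2/D_3))=\{\sigma\mid\forall i,j:\sigma,[i,j]\models D_1\Rightarrow(\forall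 k:\sigma,[i,k]\models\mathrm{focc}(D_3)\Rightarrow\exists l\le k:\sigma,[i,l]\models D_2)\}$. For boolean combinations, $L$ is given by intersection, union and complement (relative to nonempty words). Translation $\aleph$ (extended homomorphically over boolean connectives), writing $\mathrm{pref}(E)$ for $\neg((\neg E)\,\hat{}\,\mathit{true})$: $\aleph(\mathbf{pref}(D))=\neg((\neg D)\,\hat{}\,\mathit{true})$; $\aleph(\mathbf{init}(D_1/D_2))=\mathrm{pref}(\mathrm{focc}(D_2)\Rightarrow D_1\,\hat{}\,\mathit{true})$; $\aleph(\mathbf{anti}(D))=\neg(\mathit{true}\,\hat{}\,D\,\hat{}\,\mathit{true})$; $\aleph(\mathbf{implies}(D_1\leadsto D_2))=\Box(D_1\Rightarrow D_2)$; $\aleph(\mathbf{follows}(D_1\leadsto D_2/D_3))=\Box(\neg(D_1\,\hat{}\,(\mathrm{focc}(D_3)\wedge\neg(D_2\,\hat{}\,\mathit{true}))))$; $\aleph(\mathbf{triggers}(D_1\leadsto D_2/D_3))=\Box(D_1\,\hat{}\,\mathit{true}\Rightarrow(\mathrm{focc}(D_3)\Rightarrow D_2\,\hat{}\,\mathit{true}))\wedge\Box(D_1\Rightarrow\mathrm{pref}(\mathrm{focc}(D_3)\Rightarrow D_2\,\hat{}\,\mathit{true}))$. -}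

module Defs where

open import Data.Nat using (ℕ; zero; suc; _+_; _∸_; _≤_; _<_; _>_; _≥_)
open import Data.Fin using (Fin; _≟_)
open import Data.Bool using (Bool; true; false; _∧_; _∨_; not; if_then_else_)
open import Data.Product using (Σ; _×_; _,_; ∃; ∃-syntax)
open import Data.Sum using (_⊎_)
open import Data.Empty using (⊥)
open import Data.Unit using (⊤)
open import Relation.Nullary using (¬_; yes; no)
open import Relation.Binary.PropositionalEquality using (_≡_)
open import Function.Bundles using (_⇔_)

-- Alphabet: Σ = Fin m (a finite set of propositional variables).
-- Word P_0 ⋯ P_n : last index n = len, letter i : Σ → Bool is P_i
-- (characteristic function); values at i > len are irrelevant.

record Word (m : ℕ) : Set where
  constructor word
  field
    len    : ℕ
    letter : ℕ → Fin m → Bool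
open Word public

prefixOf : ∀ {m} → Word m → ℕ → Word m
prefixOf σ j = word j (letter σ)

data Prop (m : ℕ) : Set where
  var  : Fin m → Prop m
  ptt  : Prop m
  pff  : Prop m
  pnot : Prop m → Prop m
  pand : Prop m → Prop m → Prop m
  por  : Prop m → Prop m → Prop m
  pimp : Prop m → Prop m → Prop m

evalP : ∀ {m} → (Fin m → Bool) → Prop m → Bool
evalP P (var p)    = P p
evalP P ptt        = true
evalP P pff        = false
evalP P (pnot φ)   = not (evalP P φ)
evalP P (pand φ ψ) = evalP P φ ∧ evalP P ψ
evalP P (por φ ψ)  = evalP P φ ∨ evalP P ψ
evalP P (pimp φ ψ) = not (evalP P φ) ∨ evalP P ψ

holdsAt : ∀ {m} → Word m → Prop m → ℕ → Set
holdsAt σ φ i = evalP (letter σ i) φ ≡ true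

data Cmp : Set where
  lt le eq ge gt : Cmp

cmp : Cmp → ℕ → ℕ → Set
cmp lt x c = x < c
cmp le x c = x ≤ c
cmp eq x c = x ≡ c
cmp ge x c = x ≥ c
cmp gt x c = x > c

countFrom : ∀ {m} → Word m → Prop m → ℕ → ℕ → ℕ
countFrom σ φ b zero    = 0
countFrom σ φ b (suc k) =
  (if evalP (letter σ b) φ then 1 else 0) + countFrom σ φ (suc b) k

data QDDC (m : ℕ) : Set where
  ⟨_⟩     : Prop m → QDDC m
  [_]     : Prop m → QDDC m
  [[_]]   : Prop m → QDDC m
  ⦃⦃_⦄⦄   : Prop m → QDDC m
  _⁀_     : QDDC m → QDDC m → QDDC m
  ¬Q      : QDDC m → QDDC m
  _∨Q_    : QDDC m → QDDC m → QDDC m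
  _∧Q_    : QDDC m → QDDC m → QDDC m
  _⇒Q_    : QDDC m → QDDC m → QDDC m
  star    : QDDC m → QDDC m
  ∃Q      : Fin m → QDDC m → QDDC m
  ∀Q      : Fin m → QDDC m → QDDC m
  slen    : Cmp → ℕ → QDDC m
  scount  : Prop m → Cmp → ℕ → QDDC m
  sdur    : Prop m → Cmp → ℕ → QDDC m

variant : ∀ {m} → Word m → Fin m → (ℕ → Bool) → Word m
variant σ p v = word (len σ) (λ i q → f i q (q ≟ p))
  where
  f : ℕ → (q : Fin _) → _ → Bool
  f i q (yes _) = v i
  f i q (no _)  = letter σ i q

data Chops (R : ℕ → ℕ → Set) : ℕ → ℕ → Set where
  done : ∀ {b} → Chops R b b
  step : ∀ {b i e} → b ≤ i → i ≤ e → R b i → Chops R i e → Chops R b e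

-- σ,[b,e] ⊨ D   (intended for b ≤ e ≤ len σ)
sat : ∀ {m} → Word m → QDDC m → ℕ → ℕ → Set
sat σ ⟨ φ ⟩ b e        = holdsAt σ φ b
sat σ [ φ ] b e        = ∀ i → b ≤ i → i < e → holdsAt σ φ i
sat σ [[ φ ]] b e      = ∀ i → b ≤ i → i ≤ e → holdsAt σ φ i
sat σ ⦃⦃ φ ⦄⦄ b e      = (e ≡ suc b) × holdsAt σ φ b
sat σ (D₁ ⁀ D₂) b e    = ∃[ i ] (b ≤ i × i ≤ e × sat σ D₁ b i × sat σ D₂ i e)
sat σ (¬Q D) b e       = ¬ sat σ D b e
sat σ (D₁ ∨Q D₂) b e   = sat σ D₁ b e ⊎ sat σ D₂ b e
sat σ (D₁ ∧Q D₂) b e   = sat σ D₁ b e × sat σ D₂ b e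
sat σ (D₁ ⇒Q D₂) b e   = sat σ D₁ b e → sat σ D₂ b e
sat σ (star D) b e     = Chops (sat σ D) b e
sat σ (∃Q p D) b e     = ∃[ v ] sat (variant σ p v) D b e
sat σ (∀Q p D) b e     = ∀ v → sat (variant σ p v) D b e
sat σ (slen c k) b e   = cmp c (e ∸ b) k
sat σ (scount φ c k) b e = cmp c (countFrom σ φ b (suc (e ∸ b))) k
sat σ (sdur φ c k) b e = cmp c (countFrom σ φ b (e ∸ b)) k

_⊨_ : ∀ {m} → Word m → QDDC m → Set
σ ⊨ D = sat σ D 0 (len σ)

trueQ : ∀ {m} → QDDC m
trueQ = ⟨ ptt ⟩

ext : ∀ {m} → QDDC m
ext = slen gt 0

◇ : ∀ {m} → QDDC m → QDDC m
◇ D = (trueQ ⁀ D) ⁀ trueQ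

□ : ∀ {m} → QDDC m → QDDC m
□ D = ¬Q (◇ (¬Q D))

focc : ∀ {m} → QDDC m → QDDC m
focc D = D ∧Q ¬Q (D ⁀ ext)

prefQ : ∀ {m} → QDDC m → QDDC m
prefQ E = ¬Q ((¬Q E) ⁀ trueQ)

SeCe : ∀ {m} → QDDC m → Set
SeCe ⟨ φ ⟩          = ⊤
SeCe [ φ ]          = ⊤
SeCe [[ φ ]]        = ⊤
SeCe ⦃⦃ φ ⦄⦄        = ⊤
SeCe (D₁ ⁀ D₂)      = SeCe D₁ × SeCe D₂
SeCe (¬Q D)         = ⊥
SeCe (D₁ ∨Q D₂)     = SeCe D₁ × SeCe D₂
SeCe (D₁ ∧Q D₂)     = SeCe D₁ × SeCe D₂
SeCe (D₁ ⇒Q D₂)     = SeCe D₁ × SeCe D₂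
SeCe (star D)       = SeCe D
SeCe (∃Q p D)       = ⊥
SeCe (∀Q p D)       = ⊥
SeCe (slen c k)     = ⊤
SeCe (scount φ c k) = ⊤
SeCe (sdur φ c k)   = ⊤

data NL (m : ℕ) : Set where
  pref     : QDDC m → NL m
  init     : QDDC m → QDDC m → NL m
  anti     : QDDC m → NL m
  implies  : QDDC m → QDDC m → NL m
  follows  : QDDC m → QDDC m → QDDC m → NL m
  triggers : QDDC m → QDDC m → QDDC m → NL m
  notN     : NL m → NL m
  andN     : NL m → NL m → NL m
  orN      : NL m → NL m → NL m
  impN     : NL m → NL m → NL m

SeCeNL : ∀ {m} → NL m → Set
SeCeNL (pref D)             = SeCe D
SeCeNL (init D₁ D₂)         = SeCe D₁ × SeCe D₂
SeCeNL (anti D)             = SeCe D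
SeCeNL (implies D₁ D₂)      = SeCe D₁ × SeCe D₂
SeCeNL (follows D₁ D₂ D₃)   = SeCe D₁ × SeCe D₂ × SeCe D₃
SeCeNL (triggers D₁ D₂ D₃)  = SeCe D₁ × SeCe D₂ × SeCe D₃
SeCeNL (notN ζ)             = SeCeNL ζ
SeCeNL (andN ζ ξ)           = SeCeNL ζ × SeCeNL ξ
SeCeNL (orN ζ ξ)            = SeCeNL ζ × SeCeNL ξ
SeCeNL (impN ζ ξ)           = SeCeNL ζ × SeCeNL ξ

InL : ∀ {m} → NL m → Word m → Set
InL (pref D) σ =
  ∀ j → j ≤ len σ → prefixOf σ j ⊨ D
InL (init D₁ D₂) σ =
  ∀ j → j ≤ len σ → sat σ D₂ 0 j → ∃[ k ] (k ≤ j × sat σ D₁ 0 k)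
InL (anti D) σ =
  ∀ i j → i ≤ j → j ≤ len σ → ¬ sat σ D i j
InL (implies D₁ D₂) σ =
  ∀ i j → i ≤ j → j ≤ len σ → sat σ D₁ i j → sat σ D₂ i j
InL (follows D₁ D₂ D₃) σ =
  ∀ i j → i ≤ j → j ≤ len σ → sat σ D₁ i j →
  ∀ k → j ≤ k → k ≤ len σ → sat σ (focc D₃) j k →
  ∃[ l ] (j ≤ l × l ≤ k × sat σ D₂ j l)
InL (triggers D₁ D₂ D₃) σ =
  ∀ i j → i ≤ j → j ≤ len σ → sat σ D₁ i j →
  ∀ k → i ≤ k → k ≤ len σ → sat σ (focc D₃) i k →
  ∃[ l ] (i ≤ l × l ≤ k × sat σ D₂ i l)
InL (notN ζ) σ   = ¬ InL ζ σ
InL (andN ζ ξ) σ = InL ζ σ × InL ξ σ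
InL (orN ζ ξ) σ  = InL ζ σ ⊎ InL ξ σ
InL (impN ζ ξ) σ = InL ζ σ → InL ξ σ

ℵ : ∀ {m} → NL m → QDDC m
ℵ (pref D)            = ¬Q ((¬Q D) ⁀ trueQ)
ℵ (init D₁ D₂)        = prefQ (focc D₂ ⇒Q (D₁ ⁀ trueQ))
ℵ (anti D)            = ¬Q ((trueQ ⁀ D) ⁀ trueQ)
ℵ (implies D₁ D₂)     = □ (D₁ ⇒Q D₂)
ℵ (follows D₁ D₂ D₃)  =
  □ (¬Q (D₁ ⁀ (focc D₃ ∧Q ¬Q (D₂ ⁀ trueQ))))
ℵ (triggers D₁ D₂ D₃) =
  □ ((D₁ ⁀ trueQ) ⇒Q (focc D₃ ⇒Q (D₂ ⁀ trueQ)))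
  ∧Q □ (D₁ ⇒Q prefQ (focc D₃ ⇒Q (D₂ ⁀ trueQ)))
ℵ (notN ζ)   = ¬Q (ℵ ζ)
ℵ (andN ζ ξ) = ℵ ζ ∧Q ℵ ξ
ℵ (orN ζ ξ)  = ℵ ζ ∨Q ℵ ξ
ℵ (impN ζ ξ) = ℵ ζ ⇒Q ℵ ξ

-- The proof is by induction on ζ; boolean connectives are handled by the
-- congruence of ⇔ under ¬, ×, ⊎ and →, so all the content lies in the six
-- atoms.  Since the logic is read
-- constructively, □ and prefQ (which are negations of ◇-like formulas) only
-- match their "for all subintervals" reading for stable bodies; stability is
-- supplied by the fact that every SeCe formula is decidable on each interval
-- (the only non-obvious case being Kleene star).  Two further facts are
-- needed: satisfaction depends only on the letters of a word (for pref, which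
-- quantifies over prefixes), and a decidable formula that holds on [b,e] has
-- a first occurrence focc on some [b,k] with k ≤ e (for init).
module Submission where

open import Defs
open import Data.Nat using (ℕ; zero; suc; _+_; _∸_; _≤_; _<_; z≤n; s≤s; s≤s⁻¹; _≤?_; _<?_)
  renaming (_≟_ to _≟ℕ_)
open import Data.Nat.Properties
open import Data.Fin using (Fin) renaming (_≟_ to _≟F_)
open import Data.Bool using (Bool; true; not; _∧_; _∨_; if_then_else_)
open import Data.Bool.Properties using () renaming (_≟_ to _≟B_)
open import Data.Product using (_×_; _,_; ∃-syntax; proj₁)
open import Data.Product.Function.NonDependent.Propositional using (_×-⇔_)
open import Data.Sum using (_⊎_; inj₁; inj₂)
open import Data.Sum.Function.Propositional using (_⊎-⇔_)
open import Data.Unit using (tt)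
open import Function.Bundles using (_⇔_; mk⇔; module Equivalence)
open import Function.Related.TypeIsomorphisms using (¬-cong-⇔; →-cong-⇔)
open import Relation.Nullary using (¬_; Dec; yes; no)
open import Relation.Nullary.Decidable using (map′; _×-dec_; _⊎-dec_; _→-dec_; decidable-stable)
open import Relation.Nullary.Negation using (Stable; negated-stable)
open import Relation.Binary.PropositionalEquality using (_≡_; refl; sym; trans; cong; cong₂; subst)

open Equivalence using (to; from)

variable
  m : ℕ
  σ σ′ : Word m
  b e : ℕ

⇒-stable : {A B : Set} → Stable B → Stable (A → B)
⇒-stable stB ¬¬f a = stB (λ ¬b → ¬¬f (λ f → ¬b (f a)))

-- Two words agree letterwise when they have the same truth values at every
-- position (a record, so that the two words can be inferred from a proof).
record SameLetters (σ σ′ : Word m) : Set where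
  constructor same-letters
  field agree : ∀ i q → letter σ i q ≡ letter σ′ i q
open SameLetters

sym-letters : SameLetters σ σ′ → SameLetters σ′ σ
sym-letters same = same-letters (λ i q → sym (agree same i q))

evalP-cong : {P P′ : Fin m → Bool} → (∀ q → P q ≡ P′ q) → ∀ φ → evalP P φ ≡ evalP P′ φ
evalP-cong same (var p)    = same p
evalP-cong same ptt        = refl
evalP-cong same pff        = refl
evalP-cong same (pnot φ)   = cong not (evalP-cong same φ)
evalP-cong same (pand φ ψ) = cong₂ _∧_ (evalP-cong same φ) (evalP-cong same ψ)
evalP-cong same (por φ ψ)  = cong₂ _∨_ (evalP-cong same φ) (evalP-cong same ψ)
evalP-cong same (pimp φ ψ) = cong₂ _∨_ (cong not (evalP-cong same φ)) (evalP-cong same ψ)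

holdsAt-cong : SameLetters σ σ′ → ∀ φ i → holdsAt σ φ i → holdsAt σ′ φ i
holdsAt-cong same φ i h = trans (sym (evalP-cong (agree same i) φ)) h

countFrom-cong : SameLetters σ σ′ → ∀ φ b k → countFrom σ φ b k ≡ countFrom σ′ φ b k
countFrom-cong same φ b zero    = refl
countFrom-cong same φ b (suc k) =
  cong₂ _+_ (cong (if_then 1 else 0) (evalP-cong (agree same b) φ)) (countFrom-cong same φ (suc b) k)

variant-cong : ∀ {p v} → SameLetters σ σ′ → SameLetters (variant σ p v) (variant σ′ p v)
variant-cong {σ = σ} {σ′ = σ′} {p = p} {v = v} same = same-letters agree-variant
  where
  agree-variant : ∀ i q → letter (variant σ p v) i q ≡ letter (variant σ′ p v) i q
  agree-variant i q with q ≟F p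
  ... | yes _ = refl
  ... | no _  = agree same i q

mapChops : {R S : ℕ → ℕ → Set} → (∀ {b e} → R b e → S b e) → Chops R b e → Chops S b e
mapChops f done              = done
mapChops f (step p q r rest) = step p q (f r) (mapChops f rest)

sat-letters : ∀ D → SameLetters σ σ′ → sat σ D b e → sat σ′ D b e
sat-letters ⟨ φ ⟩ same h                    = holdsAt-cong same φ _ h
sat-letters [ φ ] same h                    = λ i b≤i i<e → holdsAt-cong same φ i (h i b≤i i<e)
sat-letters [[ φ ]] same h                  = λ i b≤i i≤e → holdsAt-cong same φ i (h i b≤i i≤e)
sat-letters ⦃⦃ φ ⦄⦄ same (e≡ , h)            = e≡ , holdsAt-cong same φ _ h
sat-letters (D₁ ⁀ D₂) same (i , p , q , x , y) =
  i , p , q , sat-letters D₁ same x , sat-letters D₂ same y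
sat-letters (¬Q D) same ¬d                  = λ d → ¬d (sat-letters D (sym-letters same) d)
sat-letters (D₁ ∨Q D₂) same (inj₁ x)        = inj₁ (sat-letters D₁ same x)
sat-letters (D₁ ∨Q D₂) same (inj₂ y)        = inj₂ (sat-letters D₂ same y)
sat-letters (D₁ ∧Q D₂) same (x , y)         = sat-letters D₁ same x , sat-letters D₂ same y
sat-letters (D₁ ⇒Q D₂) same f               =
  λ x → sat-letters D₂ same (f (sat-letters D₁ (sym-letters same) x))
sat-letters (star D) same c                 = mapChops (sat-letters D same) c
sat-letters (∃Q p D) same (v , d)           = v , sat-letters D (variant-cong same) d
sat-letters (∀Q p D) same f                 = λ v → sat-letters D (variant-cong same) (f v)
sat-letters (slen c k) same h               = h
sat-letters {b = b} {e = e} (scount φ c k) same h =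
  subst (λ x → cmp c x k) (countFrom-cong same φ b (suc (e ∸ b))) h
sat-letters {b = b} {e = e} (sdur φ c k) same h =
  subst (λ x → cmp c x k) (countFrom-cong same φ b (e ∸ b)) h

Chops-≤ : {R : ℕ → ℕ → Set} → Chops R b e → b ≤ e
Chops-≤ done               = ≤-refl
Chops-≤ (step b≤i i≤e _ _) = ≤-trans b≤i i≤e

-- Empty steps can be dropped: a chopping of [b,e] is either trivial or
-- begins with a step that makes progress.
ProgressingStep : (ℕ → ℕ → Set) → ℕ → ℕ → ℕ → Set
ProgressingStep R b e i = b < i × i ≤ e × R b i × Chops R i e

Chops-view : {R : ℕ → ℕ → Set} → Chops R b e →
             b ≡ e ⊎ ∃[ i ] (i < suc e × ProgressingStep R b e i)
Chops-view done = inj₁ refl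
Chops-view (step {i = i} b≤i i≤e r rest) with m≤n⇒m<n∨m≡n b≤i
... | inj₁ b<i  = inj₂ (i , s≤s i≤e , b<i , i≤e , r , rest)
... | inj₂ refl = Chops-view rest

Chops-unview : {R : ℕ → ℕ → Set} →
               b ≡ e ⊎ ∃[ i ] (i < suc e × ProgressingStep R b e i) → Chops R b e
Chops-unview (inj₁ refl)                         = done
Chops-unview (inj₂ (i , _ , b<i , i≤e , r , rest)) = step (<⇒≤ b<i) i≤e r rest

-- The Kleene closure of a decidable interval relation is decidable; the
-- recursion is on a bound n on e ∸ b, which each progressing step decreases.
Chops? : {R : ℕ → ℕ → Set} → (∀ b e → Dec (R b e)) → ∀ b e → Dec (Chops R b e)
Chops? {R = R} R? b e = bounded e b e (m≤n+m e b)
  where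
  bounded : ∀ n b e → e ≤ b + n → Dec (Chops R b e)
  bounded zero b e e≤b with b ≟ℕ e
  ... | yes refl = yes done
  ... | no b≢e   = no (λ c → b≢e (≤-antisym (Chops-≤ c) (subst (e ≤_) (+-identityʳ b) e≤b)))
  bounded (suc n) b e e≤b+n =
    map′ Chops-unview Chops-view ((b ≟ℕ e) ⊎-dec anyUpTo? progressing? (suc e))
    where
    progressing? : ∀ i → Dec (ProgressingStep R b e i)
    progressing? i with b <? i
    ... | no b≮i  = no (λ s → b≮i (proj₁ s))
    ... | yes b<i = map′ (b<i ,_) (λ { (_ , rest) → rest })
                         ((i ≤? e) ×-dec (R? b i ×-dec bounded n i e e≤i+n))
      where
      e≤i+n : e ≤ i + n
      e≤i+n = ≤-trans e≤b+n (≤-trans (≤-reflexive (+-suc b n)) (+-monoˡ-≤ n b<i))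

cmp? : ∀ c x k → Dec (cmp c x k)
cmp? lt x k = x <? k
cmp? le x k = x ≤? k
cmp? eq x k = x ≟ℕ k
cmp? ge x k = k ≤? x
cmp? gt x k = k <? x

holdsAt? : ∀ (σ : Word m) φ i → Dec (holdsAt σ φ i)
holdsAt? σ φ i = evalP (letter σ i) φ ≟B true

holdsBelow? : ∀ (σ : Word m) φ b n → Dec (∀ i → b ≤ i → i < n → holdsAt σ φ i)
holdsBelow? σ φ b n =
  map′ (λ f i b≤i i<n → f i<n b≤i) (λ g {i} i<n b≤i → g i b≤i i<n)
       (allUpTo? (λ i → (b ≤? i) →-dec holdsAt? σ φ i) n)

sat? : ∀ D → SeCe D → (σ : Word m) → ∀ b e → Dec (sat σ D b e)
sat? ⟨ φ ⟩ _ σ b e  = holdsAt? σ φ b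
sat? [ φ ] _ σ b e  = holdsBelow? σ φ b e
sat? [[ φ ]] _ σ b e =
  map′ (λ f i b≤i i≤e → f i b≤i (s≤s i≤e)) (λ g i b≤i i<1+e → g i b≤i (s≤s⁻¹ i<1+e))
       (holdsBelow? σ φ b (suc e))
sat? ⦃⦃ φ ⦄⦄ _ σ b e = (e ≟ℕ suc b) ×-dec holdsAt? σ φ b
sat? (D₁ ⁀ D₂) (s₁ , s₂) σ b e =
  map′ (λ { (i , i<1+e , b≤i , x , y) → i , b≤i , s≤s⁻¹ i<1+e , x , y })
       (λ { (i , b≤i , i≤e , x , y) → i , s≤s i≤e , b≤i , x , y })
       (anyUpTo? (λ i → (b ≤? i) ×-dec (sat? D₁ s₁ σ b i ×-dec sat? D₂ s₂ σ i e)) (suc e))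
sat? (D₁ ∨Q D₂) (s₁ , s₂) σ b e = sat? D₁ s₁ σ b e ⊎-dec sat? D₂ s₂ σ b e
sat? (D₁ ∧Q D₂) (s₁ , s₂) σ b e = sat? D₁ s₁ σ b e ×-dec sat? D₂ s₂ σ b e
sat? (D₁ ⇒Q D₂) (s₁ , s₂) σ b e = sat? D₁ s₁ σ b e →-dec sat? D₂ s₂ σ b e
sat? (star D) s σ b e           = Chops? (sat? D s σ) b e
sat? (slen c k) _ σ b e         = cmp? c (e ∸ b) k
sat? (scount φ c k) _ σ b e     = cmp? c (countFrom σ φ b (suc (e ∸ b))) k
sat? (sdur φ c k) _ σ b e       = cmp? c (countFrom σ φ b (e ∸ b)) k

sat-stable : ∀ D → SeCe D → Stable (sat σ D b e)
sat-stable {σ = σ} {b = b} {e = e} D s = decidable-stable (sat? D s σ b e)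

Somewhere : Word m → QDDC m → ℕ → ℕ → Set
Somewhere σ D b e = ∃[ i ] ∃[ j ] (b ≤ i × i ≤ j × j ≤ e × sat σ D i j)

Everywhere : Word m → QDDC m → ℕ → ℕ → Set
Everywhere σ D b e = ∀ i j → b ≤ i → i ≤ j → j ≤ e → sat σ D i j

sat-◇ : ∀ D → sat σ (◇ D) b e ⇔ Somewhere σ D b e
sat-◇ D = mk⇔
  (λ { (j , _ , j≤e , (i , b≤i , i≤j , _ , d) , _) → i , j , b≤i , i≤j , j≤e , d })
  (λ { (i , j , b≤i , i≤j , j≤e , d) →
         j , ≤-trans b≤i i≤j , j≤e , (i , b≤i , i≤j , refl , d) , refl })

sat-□ : ∀ D → (∀ i j → Stable (sat σ D i j)) → sat σ (□ D) b e ⇔ Everywhere σ D b e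
sat-□ D stable = mk⇔
  (λ ¬◇¬ i j b≤i i≤j j≤e → stable i j (λ ¬d →
     ¬◇¬ (from (sat-◇ (¬Q D)) (i , j , b≤i , i≤j , j≤e , ¬d))))
  (λ all ◇¬ → let (i , j , b≤i , i≤j , j≤e , ¬d) = to (sat-◇ (¬Q D)) ◇¬
              in ¬d (all i j b≤i i≤j j≤e))

sat-prefQ : ∀ E → (∀ j → Stable (sat σ E b j)) →
            sat σ (prefQ E) b e ⇔ (∀ j → b ≤ j → j ≤ e → sat σ E b j)
sat-prefQ E stable = mk⇔
  (λ h j b≤j j≤e → stable j (λ ¬E → h (j , b≤j , j≤e , ¬E , refl)))
  (λ all → λ { (j , b≤j , j≤e , ¬E , _) → ¬E (all j b≤j j≤e) })

sat-reach : ∀ D → sat σ (D ⁀ trueQ) b e ⇔ (∃[ l ] (b ≤ l × l ≤ e × sat σ D b l))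
sat-reach D = mk⇔ (λ { (l , b≤l , l≤e , d , _) → l , b≤l , l≤e , d })
                (λ { (l , b≤l , l≤e , d) → l , b≤l , l≤e , d , refl })

least : {P : ℕ → Set} → (∀ i → Dec (P i)) → ∀ n → ∃[ i ] (i ≤ n × P i) →
        ∃[ k ] (k ≤ n × P k × (∀ i → i < k → ¬ P i))
least P? zero (.zero , z≤n , p) = zero , z≤n , p , λ i ()
least P? (suc n) (i , i≤1+n , p) with anyUpTo? P? (suc n)
... | yes (i′ , i′<1+n , p′) =
  let (k , k≤n , pk , below) = least P? n (i′ , s≤s⁻¹ i′<1+n , p′) in k , m≤n⇒m≤1+n k≤n , pk , below
... | no none = i , i≤1+n , p , λ i′ i′<i p′ → none (i′ , <-≤-trans i′<i i≤1+n , p′)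

focc-first : ∀ (σ : Word m) D → (∀ k → Dec (sat σ D b k)) → b ≤ e → sat σ D b e →
             ∃[ k ] (b ≤ k × k ≤ e × sat σ (focc D) b k)
focc-first {b = b} {e = e} σ D D? b≤e d with least (λ k → (b ≤? k) ×-dec D? k) e (e , ≤-refl , b≤e , d)
... | k , k≤e , (b≤k , dk) , below = k , b≤k , k≤e , dk , no-earlier
  where
  no-earlier : ¬ sat σ (D ⁀ ext) b k
  no-earlier (i , b≤i , i≤k , di , 0<k∸i) = below i (m∸n≢0⇒n<m (>⇒≢ 0<k∸i)) (b≤i , di)

pref-correct : ∀ D (σ : Word m) → SeCe D → InL (pref D) σ ⇔ (σ ⊨ ℵ (pref D))
pref-correct D σ s = mk⇔
  (λ f → from prefix-sem (λ j _ j≤n → sat-letters D (same-letters (λ _ _ → refl)) (f j j≤n)))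
  (λ g j j≤n → sat-letters D (same-letters (λ _ _ → refl)) (to prefix-sem g j z≤n j≤n))
  where
  -- a prefix of σ has the same letters as σ, so D is evaluated alike on both
  prefix-sem : σ ⊨ prefQ D ⇔ (∀ j → 0 ≤ j → j ≤ len σ → sat σ D 0 j)
  prefix-sem = sat-prefQ D (λ _ → sat-stable D s)

-- Replacing a D₂-occurrence by its first occurrence only shortens the
-- prefix in which D₁ must be found.
init-correct : ∀ D₁ D₂ (σ : Word m) → SeCe D₁ → SeCe D₂ →
               InL (init D₁ D₂) σ ⇔ (σ ⊨ ℵ (init D₁ D₂))
init-correct D₁ D₂ σ s₁ s₂ = mk⇔ forward backward
  where
  C : QDDC _
  C = focc D₂ ⇒Q (D₁ ⁀ trueQ)
  prefix-sem : σ ⊨ prefQ C ⇔ (∀ j → 0 ≤ j → j ≤ len σ → sat σ C 0 j)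
  prefix-sem = sat-prefQ C (λ _ → ⇒-stable (sat-stable (D₁ ⁀ trueQ) (s₁ , tt)))
  forward : InL (init D₁ D₂) σ → σ ⊨ ℵ (init D₁ D₂)
  forward f = from prefix-sem λ j _ j≤n fo →
    let (k , k≤j , d₁) = f j j≤n (proj₁ fo) in from (sat-reach D₁) (k , z≤n , k≤j , d₁)
  backward : σ ⊨ ℵ (init D₁ D₂) → InL (init D₁ D₂) σ
  backward g j j≤n d₂ =
    let (j₀ , _ , j₀≤j , fo) = focc-first σ D₂ (sat? D₂ s₂ σ 0) z≤n d₂
        (k , _ , k≤j₀ , d₁) = to (sat-reach D₁) (to prefix-sem g j₀ z≤n (≤-trans j₀≤j j≤n) fo)
    in k , ≤-trans k≤j₀ j₀≤j , d₁

-- anti is the negation of ◇ D; no stability is needed here.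
anti-correct : ∀ D (σ : Word m) → InL (anti D) σ ⇔ (σ ⊨ ℵ (anti D))
anti-correct D σ = mk⇔
  (λ f ◇d → let (i , j , _ , i≤j , j≤n , d) = to (sat-◇ D) ◇d in f i j i≤j j≤n d)
  (λ ¬◇d i j i≤j j≤n d → ¬◇d (from (sat-◇ D) (i , j , z≤n , i≤j , j≤n , d)))

implies-correct : ∀ D₁ D₂ (σ : Word m) → SeCe D₂ →
                  InL (implies D₁ D₂) σ ⇔ (σ ⊨ ℵ (implies D₁ D₂))
implies-correct D₁ D₂ σ s₂ = mk⇔ (λ f → from □-sem (λ i j _ → f i j)) (λ g i j → to □-sem g i j z≤n)
  where
  □-sem : σ ⊨ □ (D₁ ⇒Q D₂) ⇔ Everywhere σ (D₁ ⇒Q D₂) 0 (len σ)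
  □-sem = sat-□ (D₁ ⇒Q D₂) (λ _ _ → ⇒-stable (sat-stable D₂ s₂))

follows-correct : ∀ D₁ D₂ D₃ (σ : Word m) → SeCe D₂ →
                  InL (follows D₁ D₂ D₃) σ ⇔ (σ ⊨ ℵ (follows D₁ D₂ D₃))
follows-correct D₁ D₂ D₃ σ s₂ = mk⇔ forward backward
  where
  Violation : QDDC _
  Violation = D₁ ⁀ (focc D₃ ∧Q ¬Q (D₂ ⁀ trueQ))
  □-sem : σ ⊨ □ (¬Q Violation) ⇔ Everywhere σ (¬Q Violation) 0 (len σ)
  □-sem = sat-□ (¬Q Violation) (λ _ _ → negated-stable)
  forward : InL (follows D₁ D₂ D₃) σ → σ ⊨ ℵ (follows D₁ D₂ D₃)
  forward f = from □-sem λ { i k _ i≤k k≤n (j , i≤j , j≤k , d₁ , fo , ¬reach) →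
    ¬reach (from (sat-reach D₂) (f i j i≤j (≤-trans j≤k k≤n) d₁ k j≤k k≤n fo)) }
  backward : σ ⊨ ℵ (follows D₁ D₂ D₃) → InL (follows D₁ D₂ D₃) σ
  backward g i j i≤j j≤n d₁ k j≤k k≤n fo =
    to (sat-reach D₂) (sat-stable (D₂ ⁀ trueQ) (s₂ , tt) (λ ¬reach →
      to □-sem g i k z≤n (≤-trans i≤j j≤k) k≤n (j , i≤j , j≤k , d₁ , fo , ¬reach)))

-- An occurrence of D₁ on [i,j] constrains every first D₃-occurrence [i,k]:
-- the first conjunct of ℵ handles k ≥ j, the second one k ≤ j.
triggers-correct : ∀ D₁ D₂ D₃ (σ : Word m) → SeCe D₂ →
                   InL (triggers D₁ D₂ D₃) σ ⇔ (σ ⊨ ℵ (triggers D₁ D₂ D₃))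
triggers-correct D₁ D₂ D₃ σ s₂ = mk⇔ forward backward
  where
  C : QDDC _
  C = focc D₃ ⇒Q (D₂ ⁀ trueQ)
  C-stable : ∀ {i k} → Stable (sat σ C i k)
  C-stable = ⇒-stable (sat-stable (D₂ ⁀ trueQ) (s₂ , tt))
  prefix-sem : ∀ {i j} → sat σ (prefQ C) i j ⇔ (∀ k → i ≤ k → k ≤ j → sat σ C i k)
  prefix-sem = sat-prefQ C (λ _ → C-stable)
  later : σ ⊨ □ ((D₁ ⁀ trueQ) ⇒Q C) ⇔ Everywhere σ ((D₁ ⁀ trueQ) ⇒Q C) 0 (len σ)
  later = sat-□ ((D₁ ⁀ trueQ) ⇒Q C) (λ _ _ → ⇒-stable C-stable)
  earlier : σ ⊨ □ (D₁ ⇒Q prefQ C) ⇔ Everywhere σ (D₁ ⇒Q prefQ C) 0 (len σ)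
  earlier = sat-□ (D₁ ⇒Q prefQ C) (λ _ _ → ⇒-stable negated-stable)
  forward : InL (triggers D₁ D₂ D₃) σ → σ ⊨ ℵ (triggers D₁ D₂ D₃)
  forward f =
    from later (λ { i k _ i≤k k≤n (j , i≤j , j≤k , d₁ , _) fo →
      from (sat-reach D₂) (f i j i≤j (≤-trans j≤k k≤n) d₁ k i≤k k≤n fo) }) ,
    from earlier (λ i j _ i≤j j≤n d₁ → from prefix-sem (λ k i≤k k≤j fo →
      from (sat-reach D₂) (f i j i≤j j≤n d₁ k i≤k (≤-trans k≤j j≤n) fo)))
  backward : σ ⊨ ℵ (triggers D₁ D₂ D₃) → InL (triggers D₁ D₂ D₃) σ
  backward (a , b) i j i≤j j≤n d₁ k i≤k k≤n fo with ≤-total j k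
  ... | inj₁ j≤k =
    to (sat-reach D₂) (to later a i k z≤n i≤k k≤n (from (sat-reach D₁) (j , i≤j , j≤k , d₁)) fo)
  ... | inj₂ k≤j = to (sat-reach D₂) (to prefix-sem (to earlier b i j z≤n i≤j j≤n d₁) k i≤k k≤j fo)

mainTheorem3 : ∀ {m : ℕ} (ζ : NL m) → SeCeNL ζ → (σ : Word m) →
                   InL ζ σ ⇔ (σ ⊨ ℵ ζ)
mainTheorem3 (pref D) s σ                     = pref-correct D σ s
mainTheorem3 (init D₁ D₂) (s₁ , s₂) σ         = init-correct D₁ D₂ σ s₁ s₂
mainTheorem3 (anti D) s σ                     = anti-correct D σ
mainTheorem3 (implies D₁ D₂) (_ , s₂) σ       = implies-correct D₁ D₂ σ s₂
mainTheorem3 (follows D₁ D₂ D₃) (_ , s₂ , _) σ  = follows-correct D₁ D₂ D₃ σ s₂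
mainTheorem3 (triggers D₁ D₂ D₃) (_ , s₂ , _) σ = triggers-correct D₁ D₂ D₃ σ s₂
mainTheorem3 (notN ζ) s σ                     = ¬-cong-⇔ (mainTheorem3 ζ s σ)
mainTheorem3 (andN ζ ξ) (s , t) σ             = mainTheorem3 ζ s σ ×-⇔ mainTheorem3 ξ t σ
mainTheorem3 (orN ζ ξ) (s , t) σ              = mainTheorem3 ζ s σ ⊎-⇔ mainTheorem3 ξ t σ
mainTheorem3 (impN ζ ξ) (s , t) σ             = →-cong-⇔ (mainTheorem3 ζ s σ) (mainTheorem3 ξ t σ)
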